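{- Let $n \equiv 0 \pmod 4$ and let $X = \mathrm{Cay}(\mathbb{Z}_n, S)$ be a circulant graph. Let $S_e = S \cap 2\mathbb{Z}_n$ and $S_o = S \setminus S_e$. If there exists $m \in \mathbb{Z}_n^\times$ such that $m S_e + (n/2) = S_e$ and $S_o + 2(m-1)\mathbb{Z}_n = S_o + (n/2) = S_o$, then $X$ is unstable.
   Context: All graphs are finite, simple and undirected. For an abelian group $G$ and $S \subseteq G$ with $-S = S$, $0 \notin S$, $\mathrm{Cay}(G,S)$ has vertex set $G$ with $v \sim w$ iff $w - v \in S$. $mS_e = \{ms : s \in S_e\}$, $2(m-1)\mathbb{Z}_n = \{2(m-1)x : x \in \mathbb{Z}_n\}$, and $A + B = \{a + b: a\in A, b \in B\}$. The canonical bipartite double cover $BX$ has vertex set $V(X)\times\{0,1\}$ with $(v,0)\sim(w,1)$ iff $v\sim w$ in $X$. $\mathrm{Aut}\,X \times S_2$ embeds in $\mathrm{Aut}\,BX$ via $(\varphi,\sigma)(v,i) = (\varphi(v),\sigma(i))$. $X$ is unstable if $\mathrm{Aut}\,BX \neq \mathrm{Aut}\,X \times S_2$. -}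

module Defs where

open import Data.Nat using (ℕ; NonZero; _∸_) renaming (_+_ to _+ℕ_; _*_ to _*ℕ_)
open import Data.Nat.DivMod using (_mod_; _/_)
open import Data.Fin using (Fin; toℕ)
open import Data.Fin.Subset using (Subset; _∈_; _∉_)
open import Data.Bool using (Bool; true; false)
open import Data.Product using (Σ; _×_; _,_; ∃; ∃-syntax)
open import Data.Empty using (⊥)
open import Relation.Nullary using (¬_)
open import Relation.Binary.PropositionalEquality using (_≡_)
open import Function.Bundles using (_⇔_)

module Zn (n : ℕ) .{{_ : NonZero n}} where

  [_] : ℕ → Fin n
  [ a ] = a mod n

  _⊕_ : Fin n → Fin n → Fin n
  a ⊕ b = [ toℕ a +ℕ toℕ b ]

  _⊗_ : Fin n → Fin n → Fin n
  a ⊗ b = [ toℕ a *ℕ toℕ b ]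

  ⊝_ : Fin n → Fin n
  ⊝ a = [ n ∸ toℕ a ]

  _⊖_ : Fin n → Fin n → Fin n
  a ⊖ b = a ⊕ (⊝ b)

  IsUnit : Fin n → Set
  IsUnit m = ∃[ m' ] (m ⊗ m' ≡ [ 1 ])

  half : Fin n
  half = [ n / 2 ]

  InEven : Fin n → Set
  InEven x = ∃[ y ] (x ≡ [ 2 ] ⊗ y)

  InSe : Subset n → Fin n → Set
  InSe S x = (x ∈ S) × InEven x

  InSo : Subset n → Fin n → Set
  InSo S x = (x ∈ S) × ¬ InSe S x

  InMSePlusHalf : Subset n → Fin n → Fin n → Set
  InMSePlusHalf S m x = ∃[ s ] (InSe S s × (x ≡ (m ⊗ s) ⊕ half))

  InSoPlus2m1Zn : Subset n → Fin n → Fin n → Set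
  InSoPlus2m1Zn S m x =
    ∃[ s ] ∃[ y ] (InSo S s × (x ≡ s ⊕ (([ 2 ] ⊗ (m ⊖ [ 1 ])) ⊗ y)))

  InSoPlusHalf : Subset n → Fin n → Set
  InSoPlusHalf S x = ∃[ s ] (InSo S s × (x ≡ s ⊕ half))

  IsConnectionSet : Subset n → Set
  IsConnectionSet S = (∀ x → x ∈ S → (⊝ x) ∈ S) × ([ 0 ] ∉ S)

  CayAdj : Subset n → Fin n → Fin n → Set
  CayAdj S v w = (w ⊖ v) ∈ S

record Aut {V : Set} (Adj : V → V → Set) : Set where
  field
    to      : V → V
    from    : V → V
    to-from : ∀ v → to (from v) ≡ v
    from-to : ∀ v → from (to v) ≡ v
    adj     : ∀ v w → Adj v w ⇔ Adj (to v) (to w)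

-- canonical bipartite double cover; false ≙ 0, true ≙ 1
BAdj : {V : Set} → (V → V → Set) → V × Bool → V × Bool → Set
BAdj Adj (v , false) (w , true)  = Adj v w
BAdj Adj (v , true)  (w , false) = Adj w v
BAdj Adj (v , false) (w , false) = ⊥
BAdj Adj (v , true)  (w , true)  = ⊥

InProductImage : {V : Set} (Adj : V → V → Set) → Aut (BAdj Adj) → Set
InProductImage {V} Adj ψ =
  Σ (Aut Adj) λ φ → Σ (Aut {Bool} _≡_) λ σ →
    ∀ v i → Aut.to ψ (v , i) ≡ (Aut.to φ v , Aut.to σ i)

-- X is unstable: Aut BX ≠ Aut X × S₂ (some automorphism of BX is not in the image)
Unstable : {V : Set} → (V → V → Set) → Set
Unstable Adj = ∃[ ψ ] (¬ InProductImage Adj ψ)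

{-# OPTIONS --safe #-}
-- Let α and β be the permutations of ℤ_n that fix the odd residues and act on
-- the even ones by x ↦ m x and x ↦ m x + n/2 (n/2 is even because 4 ∣ n).
-- Then w − v ∈ S iff β w − α v ∈ S.  If v and w are both even,
-- β w − α v = m (w − v) + n/2, and m S_e + n/2 = S_e.  Otherwise w − v is odd
-- and β w − α v differs from it by (m − 1) times an even number, plus n/2 when
-- w is even, and S_o is invariant under both translations.  Hence
-- (v , 0) ↦ (α v , 0), (v , 1) ↦ (β v , 1) is an automorphism of BX, and it is
-- not of the form φ × σ because α 0 = 0 ≠ n/2 = β 0.
module Submission where

open import Defs
open import Data.Nat using (ℕ; NonZero)
open import Data.Nat.Divisibility using (_∣_)
open import Data.Fin using (Fin)
open import Data.Fin.Subset using (Subset; _∈_)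
open import Data.Product using (_×_; ∃-syntax)
open import Function.Bundles using (_⇔_)

open import Data.Nat using (zero; suc; _+_; _*_; _∸_; s≤s; z≤n; >-nonZero⁻¹)
open import Data.Nat.Properties
  using (+-comm; +-suc; +-assoc; +-identityʳ; *-comm; *-assoc; *-identityˡ; *-distribˡ-+; m+[n∸m]≡n; <⇒≱)
open import Data.Nat.DivMod
  using (_%_; _/_; m%n<n; m<n⇒m%n≡m; n%n≡0; %-distribˡ-+; %-distribˡ-*; m*n/n≡m; m*[n/m]≡n; m/n<m; m/n≡0⇒m<n)
open import Data.Nat.Divisibility using (divides; ∣-trans; ∣⇒≤)
open import Data.Integer as ℤ using (ℤ; +_; -[1+_])
import Data.Integer.Properties as ℤ
open import Data.Sign as Sign using (Sign)
open import Data.Fin using (toℕ)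
open import Data.Fin.Properties using (toℕ-fromℕ<; toℕ-injective; toℕ<n; toℕ≤n; any?; _≟_)
open import Data.Bool using (Bool; true; false)
open import Data.Maybe using (Maybe; just; nothing)
open import Data.Product using (_,_; proj₁; proj₂)
open import Relation.Nullary using (¬_; Dec; yes; no; contradiction)
open import Relation.Binary.PropositionalEquality hiding ([_])
open import Function.Bundles using (Inverse; Injection; Equivalence; _↔_; mk⇔; mk↔ₛ′)
open import Function.Properties.Inverse using (↔⇒↣)
import Function.Properties.Equivalence as ⇔
open import Algebra.Bundles using (CommutativeRing)
open import Algebra.Structures using (IsCommutativeRing)
open import Algebra.Consequences.Propositional using (comm∧idˡ⇒id; comm∧invʳ⇒inv; comm∧distrˡ⇒distrʳ)
open import Algebra.Solver.Ring.AlmostCommutativeRing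
  using (AlmostCommutativeRing; fromCommutativeRing; _-Raw-AlmostCommutative⟶_)

open ≡-Reasoning

module ZnRing (n : ℕ) .{{_ : NonZero n}} where
  open Zn n

  toℕ-[] : ∀ a → toℕ [ a ] ≡ a % n
  toℕ-[] a = toℕ-fromℕ< (m%n<n a n)

  []-cong-% : ∀ {a b} → a % n ≡ b % n → [ a ] ≡ [ b ]
  []-cong-% {a} {b} eq = toℕ-injective (trans (toℕ-[] a) (trans eq (sym (toℕ-[] b))))

  [toℕ] : ∀ x → [ toℕ x ] ≡ x
  [toℕ] x = toℕ-injective (trans (toℕ-[] (toℕ x)) (m<n⇒m%n≡m (toℕ<n x)))

  [n]≡[0] : [ n ] ≡ [ 0 ]
  [n]≡[0] = []-cong-% (trans (n%n≡0 n) (sym (m<n⇒m%n≡m (>-nonZero⁻¹ n))))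

  []-homo-+ : ∀ a b → [ a + b ] ≡ [ a ] ⊕ [ b ]
  []-homo-+ a b = []-cong-% (trans (%-distribˡ-+ a b n)
    (cong₂ (λ u v → (u + v) % n) (sym (toℕ-[] a)) (sym (toℕ-[] b))))

  []-homo-* : ∀ a b → [ a * b ] ≡ [ a ] ⊗ [ b ]
  []-homo-* a b = []-cong-% (trans (%-distribˡ-* a b n)
    (cong₂ (λ u v → (u * v) % n) (sym (toℕ-[] a)) (sym (toℕ-[] b))))

  ⊕-comm : ∀ x y → x ⊕ y ≡ y ⊕ x
  ⊕-comm x y = cong [_] (+-comm (toℕ x) (toℕ y))

  ⊗-comm : ∀ x y → x ⊗ y ≡ y ⊗ x
  ⊗-comm x y = cong [_] (*-comm (toℕ x) (toℕ y))

  ⊕-assoc : ∀ x y z → (x ⊕ y) ⊕ z ≡ x ⊕ (y ⊕ z)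
  ⊕-assoc x y z = begin
    (x ⊕ y) ⊕ z                       ≡⟨ cong ((x ⊕ y) ⊕_) ([toℕ] z) ⟨
    [ toℕ x + toℕ y ] ⊕ [ toℕ z ]     ≡⟨ []-homo-+ (toℕ x + toℕ y) (toℕ z) ⟨
    [ toℕ x + toℕ y + toℕ z ]         ≡⟨ cong [_] (+-assoc (toℕ x) (toℕ y) (toℕ z)) ⟩
    [ toℕ x + (toℕ y + toℕ z) ]       ≡⟨ []-homo-+ (toℕ x) (toℕ y + toℕ z) ⟩
    [ toℕ x ] ⊕ (y ⊕ z)               ≡⟨ cong (_⊕ (y ⊕ z)) ([toℕ] x) ⟩
    x ⊕ (y ⊕ z)                       ∎

  ⊗-assoc : ∀ x y z → (x ⊗ y) ⊗ z ≡ x ⊗ (y ⊗ z)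
  ⊗-assoc x y z = begin
    (x ⊗ y) ⊗ z                       ≡⟨ cong ((x ⊗ y) ⊗_) ([toℕ] z) ⟨
    [ toℕ x * toℕ y ] ⊗ [ toℕ z ]     ≡⟨ []-homo-* (toℕ x * toℕ y) (toℕ z) ⟨
    [ toℕ x * toℕ y * toℕ z ]         ≡⟨ cong [_] (*-assoc (toℕ x) (toℕ y) (toℕ z)) ⟩
    [ toℕ x * (toℕ y * toℕ z) ]       ≡⟨ []-homo-* (toℕ x) (toℕ y * toℕ z) ⟩
    [ toℕ x ] ⊗ (y ⊗ z)               ≡⟨ cong (_⊗ (y ⊗ z)) ([toℕ] x) ⟩
    x ⊗ (y ⊗ z)                       ∎

  ⊗-distribˡ-⊕ : ∀ x y z → x ⊗ (y ⊕ z) ≡ (x ⊗ y) ⊕ (x ⊗ z)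
  ⊗-distribˡ-⊕ x y z = begin
    x ⊗ (y ⊕ z)                       ≡⟨ cong (_⊗ (y ⊕ z)) ([toℕ] x) ⟨
    [ toℕ x ] ⊗ [ toℕ y + toℕ z ]     ≡⟨ []-homo-* (toℕ x) (toℕ y + toℕ z) ⟨
    [ toℕ x * (toℕ y + toℕ z) ]       ≡⟨ cong [_] (*-distribˡ-+ (toℕ x) (toℕ y) (toℕ z)) ⟩
    [ toℕ x * toℕ y + toℕ x * toℕ z ] ≡⟨ []-homo-+ (toℕ x * toℕ y) (toℕ x * toℕ z) ⟩
    (x ⊗ y) ⊕ (x ⊗ z)                 ∎

  ⊕-identityˡ : ∀ x → [ 0 ] ⊕ x ≡ x
  ⊕-identityˡ x = begin
    [ 0 ] ⊕ x         ≡⟨ cong ([ 0 ] ⊕_) ([toℕ] x) ⟨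
    [ 0 ] ⊕ [ toℕ x ] ≡⟨ []-homo-+ 0 (toℕ x) ⟨
    [ toℕ x ]         ≡⟨ [toℕ] x ⟩
    x                 ∎

  ⊗-identityˡ : ∀ x → [ 1 ] ⊗ x ≡ x
  ⊗-identityˡ x = begin
    [ 1 ] ⊗ x         ≡⟨ cong ([ 1 ] ⊗_) ([toℕ] x) ⟨
    [ 1 ] ⊗ [ toℕ x ] ≡⟨ []-homo-* 1 (toℕ x) ⟨
    [ 1 * toℕ x ]     ≡⟨ cong [_] (*-identityˡ (toℕ x)) ⟩
    [ toℕ x ]         ≡⟨ [toℕ] x ⟩
    x                 ∎

  ⊝-inverseʳ : ∀ x → x ⊕ (⊝ x) ≡ [ 0 ]
  ⊝-inverseʳ x = begin
    x ⊕ (⊝ x)                 ≡⟨ cong (_⊕ (⊝ x)) ([toℕ] x) ⟨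
    [ toℕ x ] ⊕ [ n ∸ toℕ x ] ≡⟨ []-homo-+ (toℕ x) (n ∸ toℕ x) ⟨
    [ toℕ x + (n ∸ toℕ x) ]   ≡⟨ cong [_] (m+[n∸m]≡n (toℕ≤n x)) ⟩
    [ n ]                     ≡⟨ [n]≡[0] ⟩
    [ 0 ]                     ∎

  isCommutativeRing : IsCommutativeRing _≡_ _⊕_ _⊗_ ⊝_ [ 0 ] [ 1 ]
  isCommutativeRing = record
    { isRing = record
      { +-isAbelianGroup = record
        { isGroup = record
          { isMonoid = record
            { isSemigroup = record
              { isMagma = record { isEquivalence = isEquivalence ; ∙-cong = cong₂ _⊕_ }
              ; assoc = ⊕-assoc
              }
            ; identity = comm∧idˡ⇒id ⊕-comm ⊕-identityˡ
            }
          ; inverse = comm∧invʳ⇒inv ⊕-comm ⊝-inverseʳ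
          ; ⁻¹-cong = cong ⊝_
          }
        ; comm = ⊕-comm
        }
      ; *-cong = cong₂ _⊗_
      ; *-assoc = ⊗-assoc
      ; *-identity = comm∧idˡ⇒id ⊗-comm ⊗-identityˡ
      ; distrib = ⊗-distribˡ-⊕ , comm∧distrˡ⇒distrʳ ⊗-comm ⊗-distribˡ-⊕
      }
    ; *-comm = ⊗-comm
    }

  commutativeRing : CommutativeRing _ _
  commutativeRing = record { isCommutativeRing = isCommutativeRing }

  open CommutativeRing commutativeRing using (ring; +-abelianGroup; +-group)
    renaming (+-identityʳ to ⊕-identityʳ)
  open import Algebra.Properties.Ring ring using (-‿distribˡ-*; -‿distribʳ-*)
  open import Algebra.Properties.AbelianGroup +-abelianGroup using (⁻¹-∙-comm)
  open import Algebra.Properties.Group +-group using (ε⁻¹≈ε; ⁻¹-involutive; inverseʳ-unique)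
  open import Algebra.Properties.CommutativeSemigroup
    (CommutativeRing.+-commutativeSemigroup commutativeRing) using (interchange)

  ⊝-[0] : ⊝ [ 0 ] ≡ [ 0 ]
  ⊝-[0] = ε⁻¹≈ε

  ⊝-self-inverse : ∀ {x} → x ⊕ x ≡ [ 0 ] → ⊝ x ≡ x
  ⊝-self-inverse {x} x⊕x≡0 = sym (inverseʳ-unique x x x⊕x≡0)

  -- The ring solver needs coefficients with computable equality, so ℤ is
  -- mapped into ℤ_n rather than using ℤ_n as its own coefficient ring.
  ι : ℤ → Fin n
  ι (+ k)    = [ k ]
  ι -[1+ k ] = ⊝ [ suc k ]

  ι-⊖ : ∀ a b → ι (a ℤ.⊖ b) ≡ [ a ] ⊖ [ b ]
  ι-⊖ zero    zero    = sym (⊝-inverseʳ [ 0 ])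
  ι-⊖ zero    (suc b) = sym (⊕-identityˡ (⊝ [ suc b ]))
  ι-⊖ (suc a) zero    = begin
    [ suc a ]             ≡⟨ ⊕-identityʳ [ suc a ] ⟨
    [ suc a ] ⊕ [ 0 ]     ≡⟨ cong ([ suc a ] ⊕_) ⊝-[0] ⟨
    [ suc a ] ⊖ [ 0 ]     ∎
  ι-⊖ (suc a) (suc b) = begin
    ι (suc a ℤ.⊖ suc b)                         ≡⟨ cong ι (ℤ.[1+m]⊖[1+n]≡m⊖n a b) ⟩
    ι (a ℤ.⊖ b)                                 ≡⟨ ι-⊖ a b ⟩
    [ a ] ⊖ [ b ]                               ≡⟨ ⊕-identityˡ _ ⟨
    [ 0 ] ⊕ ([ a ] ⊖ [ b ])                     ≡⟨ cong (_⊕ ([ a ] ⊖ [ b ])) (⊝-inverseʳ [ 1 ]) ⟨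
    ([ 1 ] ⊖ [ 1 ]) ⊕ ([ a ] ⊖ [ b ])           ≡⟨ interchange [ 1 ] [ a ] (⊝ [ 1 ]) (⊝ [ b ]) ⟨
    ([ 1 ] ⊕ [ a ]) ⊕ ((⊝ [ 1 ]) ⊕ (⊝ [ b ]))   ≡⟨ cong₂ _⊕_ ([]-homo-+ 1 a) (sym (⁻¹-∙-comm [ 1 ] [ b ])) ⟨
    [ suc a ] ⊕ (⊝ ([ 1 ] ⊕ [ b ]))             ≡⟨ cong (λ u → [ suc a ] ⊖ u) ([]-homo-+ 1 b) ⟨
    [ suc a ] ⊖ [ suc b ]                       ∎

  ι-homo-+ : ∀ i j → ι (i ℤ.+ j) ≡ ι i ⊕ ι j
  ι-homo-+ (+ a)    (+ b)    = []-homo-+ a b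
  ι-homo-+ (+ a)    -[1+ b ] = ι-⊖ a (suc b)
  ι-homo-+ -[1+ a ] (+ b)    = trans (ι-⊖ b (suc a)) (⊕-comm [ b ] (⊝ [ suc a ]))
  ι-homo-+ -[1+ a ] -[1+ b ] = begin
    ⊝ [ suc (suc (a + b)) ]     ≡⟨ cong (λ u → ⊝ [ suc u ]) (+-suc a b) ⟨
    ⊝ [ suc a + suc b ]         ≡⟨ cong ⊝_ ([]-homo-+ (suc a) (suc b)) ⟩
    ⊝ ([ suc a ] ⊕ [ suc b ])   ≡⟨ ⁻¹-∙-comm [ suc a ] [ suc b ] ⟨
    (⊝ [ suc a ]) ⊕ (⊝ [ suc b ]) ∎

  signed : Sign → Fin n → Fin n
  signed Sign.+ x = x
  signed Sign.- x = ⊝ x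

  ι-◃ : ∀ s k → ι (s ℤ.◃ k) ≡ signed s [ k ]
  ι-◃ Sign.+ zero    = refl
  ι-◃ Sign.- zero    = sym ⊝-[0]
  ι-◃ Sign.+ (suc k) = refl
  ι-◃ Sign.- (suc k) = refl

  ι-sign-abs : ∀ i → ι i ≡ signed (ℤ.sign i) [ ℤ.∣ i ∣ ]
  ι-sign-abs (+ k)    = refl
  ι-sign-abs -[1+ k ] = refl

  signed-homo-* : ∀ s t x y → signed (s Sign.* t) (x ⊗ y) ≡ signed s x ⊗ signed t y
  signed-homo-* Sign.+ Sign.+ x y = refl
  signed-homo-* Sign.+ Sign.- x y = -‿distribʳ-* x y
  signed-homo-* Sign.- Sign.+ x y = -‿distribˡ-* x y
  signed-homo-* Sign.- Sign.- x y = begin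
    x ⊗ y             ≡⟨ ⁻¹-involutive (x ⊗ y) ⟨
    ⊝ ⊝ (x ⊗ y)       ≡⟨ cong ⊝_ (-‿distribʳ-* x y) ⟩
    ⊝ (x ⊗ (⊝ y))     ≡⟨ -‿distribˡ-* x (⊝ y) ⟩
    (⊝ x) ⊗ (⊝ y)     ∎

  ι-homo-* : ∀ i j → ι (i ℤ.* j) ≡ ι i ⊗ ι j
  ι-homo-* i j = begin
    ι (i ℤ.* j)                                         ≡⟨ ι-◃ (s Sign.* t) (ℤ.∣ i ∣ * ℤ.∣ j ∣) ⟩
    signed (s Sign.* t) [ ℤ.∣ i ∣ * ℤ.∣ j ∣ ]           ≡⟨ cong (signed (s Sign.* t)) ([]-homo-* ℤ.∣ i ∣ ℤ.∣ j ∣) ⟩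
    signed (s Sign.* t) ([ ℤ.∣ i ∣ ] ⊗ [ ℤ.∣ j ∣ ])     ≡⟨ signed-homo-* s t [ ℤ.∣ i ∣ ] [ ℤ.∣ j ∣ ] ⟩
    signed s [ ℤ.∣ i ∣ ] ⊗ signed t [ ℤ.∣ j ∣ ]         ≡⟨ cong₂ _⊗_ (ι-sign-abs i) (ι-sign-abs j) ⟨
    ι i ⊗ ι j                                           ∎
    where
      s = ℤ.sign i
      t = ℤ.sign j

  ι-homo-neg : ∀ i → ι (ℤ.- i) ≡ ⊝ ι i
  ι-homo-neg (+ zero)  = sym ⊝-[0]
  ι-homo-neg (+ suc k) = refl
  ι-homo-neg -[1+ k ]  = sym (⁻¹-involutive [ suc k ])

  almostCommutativeRing : AlmostCommutativeRing _ _
  almostCommutativeRing = fromCommutativeRing commutativeRing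

  ι-homomorphism : CommutativeRing.rawRing ℤ.+-*-commutativeRing
                     -Raw-AlmostCommutative⟶ almostCommutativeRing
  ι-homomorphism = record
    { ⟦_⟧ = ι ; +-homo = ι-homo-+ ; *-homo = ι-homo-* ; -‿homo = ι-homo-neg
    ; 0-homo = refl ; 1-homo = refl }

  ι-≟ : ∀ i j → Maybe (ι i ≡ ι j)
  ι-≟ i j with i ℤ.≟ j
  ... | yes i≡j = just (cong ι i≡j)
  ... | no _    = nothing

  open import Algebra.Solver.Ring (CommutativeRing.rawRing ℤ.+-*-commutativeRing)
    almostCommutativeRing ι-homomorphism ι-≟ public

  unit-cancelˡ : ∀ u u' → u ⊗ u' ≡ [ 1 ] → ∀ x → u ⊗ (u' ⊗ x) ≡ x
  unit-cancelˡ u u' uu'≡1 x = begin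
    u ⊗ (u' ⊗ x)   ≡⟨ ⊗-assoc u u' x ⟨
    (u ⊗ u') ⊗ x   ≡⟨ cong (_⊗ x) uu'≡1 ⟩
    [ 1 ] ⊗ x      ≡⟨ ⊗-identityˡ x ⟩
    x              ∎

  affine-↔ : ∀ u → IsUnit u → Fin n → Fin n ↔ Fin n
  affine-↔ u (u' , uu'≡1) t =
    mk↔ₛ′ (λ x → (u ⊗ x) ⊕ t) (λ y → u' ⊗ (y ⊖ t)) to∘from from∘to
    where
      u'u≡1 : u' ⊗ u ≡ [ 1 ]
      u'u≡1 = trans (⊗-comm u' u) uu'≡1

      to∘from : ∀ y → (u ⊗ (u' ⊗ (y ⊖ t))) ⊕ t ≡ y
      to∘from y = begin
        (u ⊗ (u' ⊗ (y ⊖ t))) ⊕ t  ≡⟨ cong (_⊕ t) (unit-cancelˡ u u' uu'≡1 (y ⊖ t)) ⟩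
        (y ⊖ t) ⊕ t               ≡⟨ solve 2 (λ y t → (y :- t) :+ t := y) refl y t ⟩
        y                         ∎

      from∘to : ∀ x → u' ⊗ (((u ⊗ x) ⊕ t) ⊖ t) ≡ x
      from∘to x = begin
        u' ⊗ (((u ⊗ x) ⊕ t) ⊖ t)  ≡⟨ cong (u' ⊗_) (solve 2 (λ v t → (v :+ t) :- t := v) refl (u ⊗ x) t) ⟩
        u' ⊗ (u ⊗ x)              ≡⟨ unit-cancelˡ u' u u'u≡1 x ⟩
        x                         ∎

module Parity (n : ℕ) .{{_ : NonZero n}} where
  open Zn n
  open ZnRing n

  even? : ∀ x → Dec (InEven x)
  even? x = any? (λ y → x ≟ ([ 2 ] ⊗ y))

  even-0 : InEven [ 0 ]
  even-0 = [ 0 ] , solve 1 (λ t → con (+ 0) := t :* con (+ 0)) refl [ 2 ]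

  even-⊕ : ∀ {x y} → InEven x → InEven y → InEven (x ⊕ y)
  even-⊕ (a , refl) (b , refl) = a ⊕ b , sym (⊗-distribˡ-⊕ [ 2 ] a b)

  even-⊗ : ∀ k {x} → InEven x → InEven (k ⊗ x)
  even-⊗ k (a , refl) = k ⊗ a , solve 3 (λ k t a → k :* (t :* a) := t :* (k :* a)) refl k [ 2 ] a

  even-⊝ : ∀ {x} → InEven x → InEven (⊝ x)
  even-⊝ (a , refl) = ⊝ a , solve 2 (λ t a → :- (t :* a) := t :* (:- a)) refl [ 2 ] a

  even-⊖ : ∀ {x y} → InEven x → InEven y → InEven (x ⊖ y)
  even-⊖ ex ey = even-⊕ ex (even-⊝ ey)

  odd-⊕-even : ∀ {x t} → ¬ InEven x → InEven t → ¬ InEven (x ⊕ t)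
  odd-⊕-even {x} {t} ox et ex⊕t =
    ox (subst InEven (solve 2 (λ x t → (x :+ t) :- t := x) refl x t) (even-⊖ ex⊕t et))

  odd-⊖-even : ∀ {x t} → ¬ InEven x → InEven t → ¬ InEven (x ⊖ t)
  odd-⊖-even ox et = odd-⊕-even ox (even-⊝ et)

  even-⊖-odd : ∀ {x y} → InEven x → ¬ InEven y → ¬ InEven (x ⊖ y)
  even-⊖-odd {x} {y} ex oy ex⊖y =
    oy (subst InEven (solve 2 (λ x y → x :- (x :- y) := y) refl x y) (even-⊖ ex ex⊖y))

  onEvens : (Fin n → Fin n) → Fin n → Fin n
  onEvens f x with even? x
  ... | yes _ = f x
  ... | no _  = x

  onEvens-even : ∀ f {x} → InEven x → onEvens f x ≡ f x
  onEvens-even f {x} ex with even? x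
  ... | yes _  = refl
  ... | no ¬ex = contradiction ex ¬ex

  onEvens-odd : ∀ f {x} → ¬ InEven x → onEvens f x ≡ x
  onEvens-odd f {x} ox with even? x
  ... | yes ex = contradiction ex ox
  ... | no _   = refl

  onEvens-inverse : ∀ g h → (∀ x → g (h x) ≡ x) → (∀ {x} → InEven x → InEven (h x)) →
    ∀ x → onEvens g (onEvens h x) ≡ x
  onEvens-inverse g h gh≡id h-even x with even? x
  ... | yes ex = trans (onEvens-even g (h-even ex)) (gh≡id x)
  ... | no ox  = onEvens-odd g ox

  onEvens-↔ : (f : Fin n ↔ Fin n) →
    (∀ {x} → InEven x → InEven (Inverse.to f x)) →
    (∀ {x} → InEven x → InEven (Inverse.from f x)) →
    Fin n ↔ Fin n
  onEvens-↔ f to-even from-even = mk↔ₛ′ (onEvens (to f)) (onEvens (from f))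
    (onEvens-inverse (to f) (from f) (strictlyInverseˡ f) from-even)
    (onEvens-inverse (from f) (to f) (strictlyInverseʳ f) to-even)
    where open Inverse

  evenAffine-↔ : ∀ u → IsUnit u → ∀ t → InEven t → Fin n ↔ Fin n
  evenAffine-↔ u u-unit@(u' , _) t et =
    onEvens-↔ (affine-↔ u u-unit t) (λ ex → even-⊕ (even-⊗ u ex) et) (λ ey → even-⊗ u' (even-⊖ ey et))

module Half (n : ℕ) .{{_ : NonZero n}} where
  open Zn n
  open ZnRing n

  half-even : 4 ∣ n → InEven half
  half-even (divides q n≡q*4) = [ q ] , (begin
    [ n / 2 ]       ≡⟨ cong [_] n/2≡2*q ⟩
    [ 2 * q ]       ≡⟨ []-homo-* 2 q ⟩
    [ 2 ] ⊗ [ q ]   ∎)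
    where
      n/2≡2*q : n / 2 ≡ 2 * q
      n/2≡2*q = begin
        n / 2          ≡⟨ cong (_/ 2) n≡q*4 ⟩
        q * 4 / 2      ≡⟨ cong (_/ 2) (*-assoc q 2 2) ⟨
        q * 2 * 2 / 2  ≡⟨ m*n/n≡m (q * 2) 2 ⟩
        q * 2          ≡⟨ *-comm q 2 ⟩
        2 * q          ∎

  half⊕half : 2 ∣ n → half ⊕ half ≡ [ 0 ]
  half⊕half 2∣n = begin
    half ⊕ half          ≡⟨ []-homo-+ (n / 2) (n / 2) ⟨
    [ n / 2 + n / 2 ]    ≡⟨ cong (λ k → [ n / 2 + k ]) (+-identityʳ (n / 2)) ⟨
    [ 2 * (n / 2) ]      ≡⟨ cong [_] (m*[n/m]≡n 2∣n) ⟩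
    [ n ]                ≡⟨ [n]≡[0] ⟩
    [ 0 ]                ∎

  half≢0 : 2 ∣ n → half ≢ [ 0 ]
  half≢0 2∣n half≡0 = <⇒≱ (m/n≡0⇒m<n n/2≡0) (∣⇒≤ 2∣n)
    where
      n/2≡0 : n / 2 ≡ 0
      n/2≡0 = begin
        n / 2         ≡⟨ m<n⇒m%n≡m (m/n<m n 2 (s≤s (s≤s z≤n))) ⟨
        n / 2 % n     ≡⟨ toℕ-[] (n / 2) ⟨
        toℕ half      ≡⟨ cong toℕ half≡0 ⟩
        toℕ [ 0 ]     ≡⟨ toℕ-[] 0 ⟩
        0 % n         ≡⟨ m<n⇒m%n≡m (>-nonZero⁻¹ n) ⟩
        0             ∎

IsTwoFoldAutomorphism : {V : Set} → (V → V → Set) → (V → V) → (V → V) → Set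
IsTwoFoldAutomorphism Adj α β = ∀ v w → Adj v w ⇔ Adj (α v) (β w)

module _ {V : Set} where

  onSides : (V → V) → (V → V) → V × Bool → V × Bool
  onSides f g (v , false) = f v , false
  onSides f g (v , true)  = g v , true

  onSides-inverse : ∀ {f g f' g'} → (∀ v → f (f' v) ≡ v) → (∀ v → g (g' v) ≡ v) →
    ∀ x → onSides f g (onSides f' g' x) ≡ x
  onSides-inverse ff'≡id gg'≡id (v , false) = cong (_, false) (ff'≡id v)
  onSides-inverse ff'≡id gg'≡id (v , true)  = cong (_, true) (gg'≡id v)

  twoFoldAutomorphism⇒unstable : (Adj : V → V → Set) (α β : V ↔ V) →
    IsTwoFoldAutomorphism Adj (Inverse.to α) (Inverse.to β) →
    ∀ v → Inverse.to α v ≢ Inverse.to β v → Unstable Adj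
  twoFoldAutomorphism⇒unstable Adj α β αβ-adj v αv≢βv = ψ , ψ∉Aut×S₂
    where
      open Inverse

      ψ : Aut (BAdj Adj)
      ψ = record
        { to      = onSides (to α) (to β)
        ; from    = onSides (from α) (from β)
        ; to-from = onSides-inverse (strictlyInverseˡ α) (strictlyInverseˡ β)
        ; from-to = onSides-inverse (strictlyInverseʳ α) (strictlyInverseʳ β)
        ; adj     = λ where
            (v , false) (w , true)  → αβ-adj v w
            (v , true)  (w , false) → αβ-adj w v
            (_ , false) (_ , false) → ⇔.refl
            (_ , true)  (_ , true)  → ⇔.refl
        }

      ψ∉Aut×S₂ : ¬ InProductImage Adj ψ
      ψ∉Aut×S₂ (_ , _ , ψ≡φ×σ) =
        αv≢βv (trans (cong proj₁ (ψ≡φ×σ v false)) (sym (cong proj₁ (ψ≡φ×σ v true))))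

module Circulant (n : ℕ) .{{_ : NonZero n}} (4∣n : 4 ∣ n) (S : Subset n)
  (m : Fin n) (m-unit : Zn.IsUnit n m)
  (mSe+half≡Se : ∀ x → Zn.InMSePlusHalf n S m x ⇔ Zn.InSe n S x)
  (So+2[m-1]Zn≡So : ∀ x → Zn.InSoPlus2m1Zn n S m x ⇔ Zn.InSo n S x)
  (So+half≡So : ∀ x → Zn.InSoPlusHalf n S x ⇔ Zn.InSo n S x) where

  open Zn n
  open ZnRing n
  open Parity n
  open Half n
  open Inverse using (to)
  open Equivalence using () renaming (to to ⇒; from to ⇐)

  2∣n : 2 ∣ n
  2∣n = ∣-trans (divides 2 refl) 4∣n

  even-half : InEven half
  even-half = half-even 4∣n

  α β : Fin n ↔ Fin n
  α = evenAffine-↔ m m-unit [ 0 ] even-0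
  β = evenAffine-↔ m m-unit half even-half

  c : Fin n
  c = [ 2 ] ⊗ (m ⊖ [ 1 ])

  odd∈S⇒So : ∀ {x} → x ∈ S → ¬ InEven x → InSo S x
  odd∈S⇒So x∈S ox = x∈S , λ x∈Se → ox (proj₂ x∈Se)

  even-∈S⇔affine : ∀ {d} → InEven d → d ∈ S ⇔ ((m ⊗ d) ⊕ half) ∈ S
  even-∈S⇔affine {d} ed = mk⇔
    (λ d∈S → proj₁ (⇒ (mSe+half≡Se _) (d , (d∈S , ed) , refl)))
    (λ md+h∈S → d∈S (⇐ (mSe+half≡Se _) (md+h∈S , even-⊕ (even-⊗ m ed) even-half)))
    where
      d∈S : InMSePlusHalf S m ((m ⊗ d) ⊕ half) → d ∈ S
      d∈S (s , (s∈S , _) , md+h≡ms+h) =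
        subst (_∈ S) (Injection.injective (↔⇒↣ (affine-↔ m m-unit half)) (sym md+h≡ms+h)) s∈S

  odd-∈S⇔translate : ∀ t → InEven t →
    (∀ {s} → InSo S s → InSo S (s ⊕ t)) → (∀ {s} → InSo S s → InSo S (s ⊖ t)) →
    ∀ {d} → ¬ InEven d → d ∈ S ⇔ (d ⊕ t) ∈ S
  odd-∈S⇔translate t et So+t So-t {d} od = mk⇔
    (λ d∈S → proj₁ (So+t (odd∈S⇒So d∈S od)))
    (λ d+t∈S → subst (_∈ S) (solve 2 (λ d t → (d :+ t) :- t := d) refl d t)
                 (proj₁ (So-t (odd∈S⇒So d+t∈S (odd-⊕-even od et)))))

  even-c⊗ : ∀ y → InEven (c ⊗ y)
  even-c⊗ y = (m ⊖ [ 1 ]) ⊗ y , ⊗-assoc [ 2 ] (m ⊖ [ 1 ]) y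

  odd-∈S⇔shift : ∀ y {d} → ¬ InEven d → d ∈ S ⇔ (d ⊕ (c ⊗ y)) ∈ S
  odd-∈S⇔shift y = odd-∈S⇔translate (c ⊗ y) (even-c⊗ y)
    (λ {s} s∈So → ⇒ (So+2[m-1]Zn≡So _) (s , y , s∈So , refl))
    (λ {s} s∈So → ⇒ (So+2[m-1]Zn≡So _)
      (s , ⊝ y , s∈So , solve 3 (λ s c y → s :- (c :* y) := s :+ (c :* (:- y))) refl s c y))

  odd-∈S⇔half : ∀ {d} → ¬ InEven d → d ∈ S ⇔ (d ⊕ half) ∈ S
  odd-∈S⇔half = odd-∈S⇔translate half even-half
    (λ {s} s∈So → ⇒ (So+half≡So _) (s , s∈So , refl))
    (λ {s} s∈So → ⇒ (So+half≡So _) (s , s∈So , cong (s ⊕_) (⊝-self-inverse (half⊕half 2∣n))))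

  α-even : ∀ {x} → InEven x → to α x ≡ (m ⊗ x) ⊕ [ 0 ]
  α-even = onEvens-even _

  β-even : ∀ {x} → InEven x → to β x ≡ (m ⊗ x) ⊕ half
  β-even = onEvens-even _

  α-odd : ∀ {x} → ¬ InEven x → to α x ≡ x
  α-odd = onEvens-odd _

  β-odd : ∀ {x} → ¬ InEven x → to β x ≡ x
  β-odd = onEvens-odd _

  adj-even-even : ∀ {v w} → InEven v → InEven w → CayAdj S v w ⇔ CayAdj S (to α v) (to β w)
  adj-even-even {v} {w} ev ew rewrite α-even ev | β-even ew =
    subst (λ t → (w ⊖ v) ∈ S ⇔ t ∈ S)
      (solve 4 (λ m v w h → (m :* (w :- v)) :+ h := ((m :* w) :+ h) :- ((m :* v) :+ con (+ 0))) refl m v w half)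
      (even-∈S⇔affine (even-⊖ ew ev))

  adj-even-odd : ∀ {v w} → InEven v → ¬ InEven w → CayAdj S v w ⇔ CayAdj S (to α v) (to β w)
  adj-even-odd {_} {w} ev@(a , refl) ow rewrite α-even ev | β-odd ow =
    subst (λ t → (w ⊖ ([ 2 ] ⊗ a)) ∈ S ⇔ t ∈ S)
      (solve 3 (λ m w a → (w :- (con (+ 2) :* a)) :+ ((con (+ 2) :* (m :- con (+ 1))) :* (:- a))
                        := w :- ((m :* (con (+ 2) :* a)) :+ con (+ 0))) refl m w a)
      (odd-∈S⇔shift (⊝ a) (odd-⊖-even ow ev))

  adj-odd-even : ∀ {v w} → ¬ InEven v → InEven w → CayAdj S v w ⇔ CayAdj S (to α v) (to β w)
  adj-odd-even {v} {_} ov ew@(b , refl) rewrite α-odd ov | β-even ew =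
    subst (λ t → (([ 2 ] ⊗ b) ⊖ v) ∈ S ⇔ t ∈ S)
      (solve 4 (λ m v b h → (((con (+ 2) :* b) :- v) :+ ((con (+ 2) :* (m :- con (+ 1))) :* b)) :+ h
                          := ((m :* (con (+ 2) :* b)) :+ h) :- v) refl m v b half)
      (⇔.trans (odd-∈S⇔shift b od) (odd-∈S⇔half (odd-⊕-even od (even-c⊗ b))))
    where
      od : ¬ InEven (([ 2 ] ⊗ b) ⊖ v)
      od = even-⊖-odd ew ov

  adj-odd-odd : ∀ {v w} → ¬ InEven v → ¬ InEven w → CayAdj S v w ⇔ CayAdj S (to α v) (to β w)
  adj-odd-odd ov ow rewrite α-odd ov | β-odd ow = ⇔.refl

  αβ-twoFold : IsTwoFoldAutomorphism (CayAdj S) (to α) (to β)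
  αβ-twoFold v w = byParity (even? v) (even? w)
    where
      byParity : Dec (InEven v) → Dec (InEven w) → CayAdj S v w ⇔ CayAdj S (to α v) (to β w)
      byParity (yes ev) (yes ew) = adj-even-even ev ew
      byParity (yes ev) (no ow)  = adj-even-odd ev ow
      byParity (no ov)  (yes ew) = adj-odd-even ov ew
      byParity (no ov)  (no ow)  = adj-odd-odd ov ow

  α0≢β0 : to α [ 0 ] ≢ to β [ 0 ]
  α0≢β0 α0≡β0 = half≢0 2∣n (begin
    half                                         ≡⟨ solve 2 (λ m h → h := ((m :* con (+ 0)) :+ h)
                                                                  :- ((m :* con (+ 0)) :+ con (+ 0))) refl m half ⟩
    ((m ⊗ [ 0 ]) ⊕ half) ⊖ ((m ⊗ [ 0 ]) ⊕ [ 0 ]) ≡⟨ cong₂ _⊖_ (β-even even-0) (α-even even-0) ⟨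
    to β [ 0 ] ⊖ to α [ 0 ]                      ≡⟨ cong (_⊖ to α [ 0 ]) α0≡β0 ⟨
    to α [ 0 ] ⊖ to α [ 0 ]                      ≡⟨ ⊝-inverseʳ (to α [ 0 ]) ⟩
    [ 0 ]                                        ∎)

corollary3p12 : (n : ℕ) .{{nz : NonZero n}} → 4 ∣ n → (S : Subset n) →
    Zn.IsConnectionSet n S →
    (∃[ m ] (Zn.IsUnit n m
      × (∀ x → Zn.InMSePlusHalf n S m x ⇔ Zn.InSe n S x)
      × (∀ x → Zn.InSoPlus2m1Zn n S m x ⇔ Zn.InSo n S x)
      × (∀ x → Zn.InSoPlusHalf n S x ⇔ Zn.InSo n S x))) →
    Unstable (Zn.CayAdj n S)
corollary3p12 n 4∣n S _ (m , m-unit , mSe+half≡Se , So+2[m-1]Zn≡So , So+half≡So) =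
  twoFoldAutomorphism⇒unstable (Zn.CayAdj n S) α β αβ-twoFold (Zn.[_] n 0) α0≢β0
  where open Circulant n 4∣n S m m-unit mSe+half≡Se So+2[m-1]Zn≡So So+half≡So
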